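{- Let $G$ be a connected graph with $\mathrm{fxd}(G)=1$. Then (i) $|\mathcal{O}(v)|=|\mathrm{Aut}(G)|$ for all $v\in V(G)$; and (ii) $G$ has no fixed vertices.
   Context: Graphs are finite and simple with nontrivial automorphism group $\mathrm{Aut}(G)$ (standing assumption). For $S\subseteq V(G)$, $\mathrm{stab}(S)=\{g\in \mathrm{Aut}(G): g(v)=v \text{ for all } v\in S\}$; $S$ is a fixing set if $\mathrm{stab}(S)$ is trivial. $\mathrm{fxd}(G)$ is the minimum $k$ such that every $k$-element subset of $V(G)$ is a fixing set. The orbit of $v$ is $\mathcal{O}(v)=\{g(v): g\in\mathrm{Aut}(G)\}$. A vertex $v$ is fixed if $\mathrm{stab}(\{v\})=\mathrm{Aut}(G)$. -}

module Defs where

open import Level using (0ℓ)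
open import Data.Nat using (ℕ; _<_; suc)
open import Data.Bool using (Bool; true; false)
open import Data.Fin using (Fin)
open import Data.Fin.Subset using (Subset; _∈_; ∣_∣)
open import Data.Fin.Permutation using (Permutation′; _⟨$⟩ʳ_)
open import Data.Product using (Σ; ∃; _×_; proj₁)
open import Relation.Nullary using (¬_)
open import Relation.Binary.PropositionalEquality using (_≡_; refl; sym; trans; isEquivalence)
open import Relation.Binary.Bundles using (Setoid)
open import Function.Bundles using (Bijection)

record Graph (n : ℕ) : Set where
  field
    adj     : Fin n → Fin n → Bool
    adj-sym : ∀ u v → adj u v ≡ adj v u
    irrefl  : ∀ v → adj v v ≡ false
open Graph public

data Reachable {n : ℕ} (G : Graph n) : Fin n → Fin n → Set where
  here : ∀ {v} → Reachable G v v
  step : ∀ {u w v} → adj G u w ≡ true → Reachable G w v → Reachable G u v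

Connected : ∀ {n} → Graph n → Set
Connected {n} G = (u v : Fin n) → Reachable G u v

IsAut : ∀ {n} → Graph n → Permutation′ n → Set
IsAut {n} G σ = (u v : Fin n) → adj G (σ ⟨$⟩ʳ u) (σ ⟨$⟩ʳ v) ≡ adj G u v

Aut : ∀ {n} → Graph n → Set
Aut {n} G = Σ (Permutation′ n) (IsAut G)

app : ∀ {n} (G : Graph n) → Aut G → Fin n → Fin n
app G g x = proj₁ g ⟨$⟩ʳ x

IsIdentity : ∀ {n} (G : Graph n) → Aut G → Set
IsIdentity {n} G g = (x : Fin n) → app G g x ≡ x

AutSetoid : ∀ {n} → Graph n → Setoid 0ℓ 0ℓ
AutSetoid {n} G = record
  { Carrier = Aut G
  ; _≈_ = λ g h → (x : Fin n) → app G g x ≡ app G h x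
  ; isEquivalence = record
      { refl = λ x → refl
      ; sym = λ p x → sym (p x)
      ; trans = λ p q x → trans (p x) (q x) } }

-- Aut(G) is nontrivial (standing assumption).
AutNontrivial : ∀ {n} → Graph n → Set
AutNontrivial G = ∃ λ (g : Aut G) → ¬ IsIdentity G g

InStab : ∀ {n} (G : Graph n) → Subset n → Aut G → Set
InStab {n} G S g = (v : Fin n) → v ∈ S → app G g v ≡ v

IsFixingSet : ∀ {n} → Graph n → Subset n → Set
IsFixingSet G S = (g : Aut G) → InStab G S g → IsIdentity G g

AllFixing : ∀ {n} → Graph n → ℕ → Set
AllFixing {n} G k = (S : Subset n) → ∣ S ∣ ≡ k → IsFixingSet G S

FxdIs : ∀ {n} → Graph n → ℕ → Set
FxdIs G m = AllFixing G m × ((k : ℕ) → k < m → ¬ AllFixing G k)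

Orbit : ∀ {n} → Graph n → Fin n → Set
Orbit {n} G v = Σ (Fin n) λ w → ∃ λ (g : Aut G) → app G g v ≡ w

OrbitSetoid : ∀ {n} → Graph n → Fin n → Setoid 0ℓ 0ℓ
OrbitSetoid G v = record
  { Carrier = Orbit G v
  ; _≈_ = λ a b → proj₁ a ≡ proj₁ b
  ; isEquivalence = record
      { refl = refl ; sym = sym ; trans = trans } }

IsFixedVertex : ∀ {n} → Graph n → Fin n → Set
IsFixedVertex G v = (g : Aut G) → app G g v ≡ v

-- A fixing singleton ⁅ v ⁆ makes the action of Aut(G) on the orbit of v regular:
-- if g v ≡ h v then g⁻¹ ∘ h fixes v, hence is the identity, so g ↦ g v is a
-- bijection from Aut(G) onto the orbit.  A fixed vertex v would put every
-- automorphism in stab(⁅ v ⁆), contradicting nontriviality.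
module Submission where

open import Defs
open import Data.Nat using (ℕ)
open import Data.Fin using (Fin)
open import Data.Fin.Subset using (⁅_⁆)
open import Data.Fin.Subset.Properties using (∣⁅x⁆∣≡1; x∈⁅y⁆⇒x≡y)
open import Data.Fin.Permutation using (_⟨$⟩ʳ_; _⟨$⟩ˡ_; _∘ₚ_; flip; inverseˡ; inverseʳ)
open import Data.Product using (_×_; _,_; proj₁)
open import Relation.Nullary using (¬_)
open import Function.Bundles using (Bijection)
open import Relation.Binary.Bundles using (Setoid)
open import Relation.Binary.PropositionalEquality

module _ {n : ℕ} (G : Graph n) where

  open Setoid (AutSetoid G) using (_≈_)

  aut⁻¹ : Aut G → Aut G
  aut⁻¹ (σ , σ-aut) = flip σ , λ u v →
    trans (sym (σ-aut (σ ⟨$⟩ˡ u) (σ ⟨$⟩ˡ v)))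
          (cong₂ (adj G) (inverseʳ σ) (inverseʳ σ))

  -- Permutation composition is diagrammatic: app (σ ∘ₚ τ) x ≡ τ ⟨$⟩ʳ (σ ⟨$⟩ʳ x).
  _∘ᵃ_ : Aut G → Aut G → Aut G
  (σ , σ-aut) ∘ᵃ (τ , τ-aut) =
    σ ∘ₚ τ , λ u v → trans (τ-aut (σ ⟨$⟩ʳ u) (σ ⟨$⟩ʳ v)) (σ-aut u v)

  inStab-⁅⁆ : ∀ {v} (g : Aut G) → app G g v ≡ v → InStab G ⁅ v ⁆ g
  inStab-⁅⁆ {v} g gv≡v w w∈⁅v⁆ rewrite x∈⁅y⁆⇒x≡y v w∈⁅v⁆ = gv≡v

  fxd≡1⇒singleton-fixing : FxdIs G 1 → (v : Fin n) → IsFixingSet G ⁅ v ⁆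
  fxd≡1⇒singleton-fixing (all-1-fixing , _) v = all-1-fixing ⁅ v ⁆ (∣⁅x⁆∣≡1 v)

  module _ {v : Fin n} (⁅v⁆-fixing : IsFixingSet G ⁅ v ⁆) where

    agree-at⇒≈ : (g h : Aut G) → app G g v ≡ app G h v
               → g ≈ h
    agree-at⇒≈ g h gv≡hv x = begin
      app G g x                        ≡⟨ cong (proj₁ g ⟨$⟩ʳ_) (sym (g⁻¹∘h≈id x)) ⟩
      app G g (app G (h ∘ᵃ aut⁻¹ g) x) ≡⟨ inverseʳ (proj₁ g) ⟩
      app G h x                        ∎
      where
        open ≡-Reasoning
        g⁻¹∘h≈id : IsIdentity G (h ∘ᵃ aut⁻¹ g)
        g⁻¹∘h≈id = ⁅v⁆-fixing (h ∘ᵃ aut⁻¹ g) (inStab-⁅⁆ (h ∘ᵃ aut⁻¹ g)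
          (trans (cong (proj₁ g ⟨$⟩ˡ_) (sym gv≡hv)) (inverseˡ (proj₁ g))))

    orbit↔aut : Bijection (OrbitSetoid G v) (AutSetoid G)
    orbit↔aut = record
      { to        = λ (_ , g , _) → g
      ; cong      = λ { {_ , g , refl} {_ , h , refl} → agree-at⇒≈ g h }
      ; bijective =
          (λ { {_ , g , refl} {_ , h , refl} g≈h → g≈h v })
        , λ g → (app G g v , g , refl) , λ { {_ , h , refl} → agree-at⇒≈ h g }
      }

    ¬fixed : AutNontrivial G → ¬ IsFixedVertex G v
    ¬fixed (g , g≉id) v-fixed = g≉id (⁅v⁆-fixing g (inStab-⁅⁆ g (v-fixed g)))

proposition2 : {n : ℕ} (G : Graph n) → AutNontrivial G → Connected G → FxdIs G 1
    → ((v : Fin n) → Bijection (OrbitSetoid G v) (AutSetoid G))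
    × ((v : Fin n) → ¬ IsFixedVertex G v)
proposition2 G nontrivial _ fxd≡1 =
    (λ v → orbit↔aut G (singleton-fixing v))
  , (λ v → ¬fixed G (singleton-fixing v) nontrivial)
  where
    singleton-fixing = fxd≡1⇒singleton-fixing G fxd≡1
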